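{- For every prime number $n$ with $n \bmod 168\notin\{1, 25, 121\}$, there exist positive integers $a\le b\le c$ with $\frac{4}{n}=\frac{1}{a}+\frac{1}{b}+\frac{1}{c}$. More precisely, $$\mathbb N\setminus \mathcal C_2\subset \{n\in\mathbb N : n\equiv 1,\ 5^2,\ 11^2 \pmod{168}\}.$$
   Context: $\mathbb N$ denotes the positive integers. For $n\in\mathbb N$, a solution of $\frac{4}{n}=\frac{1}{a}+\frac{1}{b}+\frac{1}{c}$ means positive integers $a\le b\le c$ (not necessarily distinct) satisfying this equality. For $i\in\mathbb N$, $\mathcal C_i$ denotes the set of all $n\in\mathbb N$ for which this equation has a solution with $a\le \frac{n+4i-1}{4}$. -}

module Defs where

open import Data.Nat using (ℕ; _+_; _*_; _∸_; _≤_; NonZero)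
open import Relation.Binary.PropositionalEquality using (_≡_)
open import Data.Product using (Σ; _×_; ∃-syntax)

-- The equation is cleared of denominators (all of n, a,
-- b, c are positive): 4/n = 1/a+1/b+1/c  ⟺  4abc = n(bc + ac + ab).
record Solution (n a b c : ℕ) : Set where
  field
    a-pos : NonZero a
    b-pos : NonZero b
    c-pos : NonZero c
    a≤b   : a ≤ b
    b≤c   : b ≤ c
    eqn   : 4 * a * b * c ≡ n * (b * c + a * c + a * b)

-- n ∈ 𝒞ᵢ : the equation has a solution with a ≤ (n + 4i - 1)/4,
-- i.e. (multiplying by 4) 4a ≤ n + 4i - 1.
_∈𝒞_ : ℕ → ℕ → Set
n ∈𝒞 i = ∃[ a ] ∃[ b ] ∃[ c ] (Solution n a b c × 4 * a ≤ n + 4 * i ∸ 1)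

module Submission where

-- The proof is a covering of ℕ by arithmetic progressions.  For each of the
-- progressions  4ℕ+4, 4ℕ+2, 4ℕ+3, 8ℕ+5, 24ℕ+9, 24ℕ+17, 168ℕ+49, 168ℕ+73,
-- 168ℕ+97 and 168ℕ+145  an explicit polynomial family of solutions is given;
-- its defining identity is a polynomial identity in the progression
-- parameter, discharged by the ring solver.  Solutions are written in "gap
-- form" (a, a + x, a + x + y), which makes a ≤ b ≤ c automatic.
--
-- The case split is then a refinement tree: split n modulo 4; the class
-- 1 (mod 4) is refined modulo 8, the class 1 (mod 8) modulo 24 and the class
-- 1 (mod 24) modulo 168.  Of the seven classes modulo 168 that remain, four
-- are covered by families and three are exactly the exceptional ones.

open import Defs
open import Data.Nat using (ℕ; zero; suc; _+_; _*_; _∸_; _%_; _≤_; NonZero; ≢-nonZero⁻¹)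
open import Data.Nat.Properties using (m≤m+n; +-suc; *-identityʳ)
open import Data.Nat.DivMod using (_divMod_; result; [m+kn]%n≡m%n)
open import Data.Nat.Tactic.RingSolver using (solve; solve-∀)
open import Data.Fin using (Fin; toℕ)
open import Data.Fin.Patterns using (0F; 1F; 2F; 3F; 4F; 5F; 6F)
open import Data.List using (_∷_; [])
open import Data.Product using (Σ-syntax; _,_)
open import Data.Sum using (_⊎_; inj₁; inj₂)
open import Data.Empty using (⊥-elim)
open import Relation.Nullary using (¬_)
open import Relation.Binary.PropositionalEquality
  using (_≡_; refl; sym; trans; cong; subst; module ≡-Reasoning)

gapWitness : (n a' x y d : ℕ) →
  4 * suc a' * (suc a' + x) * (suc a' + x + y) ≡
    n * ((suc a' + x) * (suc a' + x + y) + suc a' * (suc a' + x + y)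
         + suc a' * (suc a' + x)) →
  4 * suc a' + d ≡ n + 7 →
  n ∈𝒞 2
gapWitness n a' x y d identity bound =
  suc a' , suc a' + x , suc a' + x + y , solution , smallest≤
  where
  solution : Solution n (suc a') (suc a' + x) (suc a' + x + y)
  solution = record
    { a-pos = _ ; b-pos = _ ; c-pos = _
    ; a≤b = m≤m+n (suc a') x
    ; b≤c = m≤m+n (suc a' + x) y
    ; eqn = identity
    }

  n+8∸1 : n + 8 ∸ 1 ≡ n + 7
  n+8∸1 rewrite +-suc n 7 = refl

  smallest≤ : 4 * suc a' ≤ n + 4 * 2 ∸ 1
  smallest≤ = subst (4 * suc a' ≤_) (trans bound (sym n+8∸1)) (m≤m+n (4 * suc a') d)

-- n = 4t + 4:  a = t + 2,  b = c = 2(t + 1)(t + 2).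
fourMultiples : ∀ t → (4 + t * 4) ∈𝒞 2
fourMultiples t = gapWitness (4 + t * 4) (suc t) ((t + 2) * (2 * t + 1)) 0 3
  (solve (t ∷ [])) (solve (t ∷ []))

-- n = 4t + 2:  a = t + 1,  b = 2t² + 3t + 2,  c = b(b − 1),
-- from 2/(2t+1) = 1/(t+1) + 1/((2t+1)(t+1)) and 1/m = 1/(m+1) + 1/(m(m+1)).
twoMod4 : ∀ t → (2 + t * 4) ∈𝒞 2
twoMod4 t = gapWitness (2 + t * 4) t (2 * t * t + 2 * t + 1)
  ((2 * t * t + 3 * t) * (2 * t * t + 3 * t + 2)) 5
  (solve (t ∷ [])) (solve (t ∷ []))

-- n = 4t + 3:  a = t + 1,  b = 4t² + 7t + 4,  c = b(b − 1),
-- from 4/(4t+3) = 1/(t+1) + 1/((4t+3)(t+1)) and the same splitting of 1/m.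
threeMod4 : ∀ t → (3 + t * 4) ∈𝒞 2
threeMod4 t = gapWitness (3 + t * 4) t (4 * t * t + 6 * t + 3)
  ((4 * t * t + 7 * t + 2) * (4 * t * t + 7 * t + 4)) 6
  (solve (t ∷ [])) (solve (t ∷ []))

-- n = 8t + 5:  a = 2t + 2,  b = (8t + 5)(t + 1),  c = 2b.
fiveMod8 : ∀ t → (5 + t * 8) ∈𝒞 2
fiveMod8 t = gapWitness (5 + t * 8) (2 * t + 1) (8 * t * t + 11 * t + 3)
  ((8 * t + 5) * (t + 1)) 4
  (solve (t ∷ [])) (solve (t ∷ []))

-- n = 24t + 9:  a = 6t + 3,  b = 48t² + 42t + 10,  c = b(b − 1).
nineMod24 : ∀ t → (9 + t * 24) ∈𝒞 2
nineMod24 t = gapWitness (9 + t * 24) (6 * t + 2) (48 * t * t + 36 * t + 7)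
  ((48 * t * t + 42 * t + 8) * (48 * t * t + 42 * t + 10)) 4
  (solve (t ∷ [])) (solve (t ∷ []))

-- n = 24t + 17:  a = 6t + 5,  b = (6t + 5)(8t + 6),  c = b n.
seventeenMod24 : ∀ t → (17 + t * 24) ∈𝒞 2
seventeenMod24 t = gapWitness (17 + t * 24) (6 * t + 4) ((6 * t + 5) * (8 * t + 5))
  ((24 * t + 16) * (6 * t + 5) * (8 * t + 6)) 4
  (solve (t ∷ [])) (solve (t ∷ []))

-- n = 168t + 49:  a = 42t + 14,  b = 1008t² + 630t + 99,  c = b(b − 1).
fortyNineMod168 : ∀ t → (49 + t * 168) ∈𝒞 2
fortyNineMod168 t = gapWitness (49 + t * 168) (42 * t + 13)
  ((24 * t + 6) * (42 * t + 14) + 1)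
  ((1008 * t * t + 630 * t + 97) * (1008 * t * t + 630 * t + 99)) 0
  (solve (t ∷ [])) (solve (t ∷ []))

-- n = 168t + 73:  a = 42t + 20,  b = 1008t² + 942t + 219.
seventyThreeMod168 : ∀ t → (73 + t * 168) ∈𝒞 2
seventyThreeMod168 t = gapWitness (73 + t * 168) (42 * t + 19)
  (1008 * t * t + 900 * t + 199)
  ((168 * t + 73) * (6 * t + 3) * (42 * t + 19)) 0
  (solve (t ∷ [])) (solve (t ∷ []))

-- n = 168t + 97:  a = 42t + 26,  b = (42t + 26)(24t + 14),  c = b n.
ninetySevenMod168 : ∀ t → (97 + t * 168) ∈𝒞 2
ninetySevenMod168 t = gapWitness (97 + t * 168) (42 * t + 25)
  ((42 * t + 26) * (24 * t + 13))
  ((168 * t + 96) * (42 * t + 26) * (24 * t + 14)) 0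
  (solve (t ∷ [])) (solve (t ∷ []))

-- n = 168t + 145:  a = 42t + 38,  b = (42t + 38)(24t + 21).
oneFortyFiveMod168 : ∀ t → (145 + t * 168) ∈𝒞 2
oneFortyFiveMod168 t = gapWitness (145 + t * 168) (42 * t + 37)
  ((42 * t + 38) * (24 * t + 20))
  ((24 * t + 21) * (3528 * t * t + 6195 * t + 2717)) 0
  (solve (t ∷ [])) (solve (t ∷ []))

-- n lies in the progression r + mℕ, witnessed by its index t.  A record
-- rather than an ∃, so that m and r are recovered from the type by plain
-- unification instead of by inverting r + t * m.
record InProgression (m r n : ℕ) : Set where
  constructor member
  field
    index    : ℕ
    position : n ≡ r + index * m

coveredBy : ∀ {m r n} → (∀ t → (r + t * m) ∈𝒞 2) → InProgression m r n → n ∈𝒞 2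
coveredBy family (member t n≡) = subst (_∈𝒞 2) (sym n≡) (family t)

residueIn : ∀ {m r n} .{{_ : NonZero m}} → InProgression m r n → n % m ≡ r % m
residueIn {m} {r} (member t refl) = [m+kn]%n≡m%n r t m

trivialProgression : ∀ n → InProgression 1 0 n
trivialProgression n = member n (sym (*-identityʳ n))

-- Regrouping r + (j + qk)m as a member of (r + jm) + (km)ℕ.  Kept opaque:
-- the solver-generated proof term is large and must never be unfolded when
-- refinements are computed for concrete moduli.
opaque
  regroup : ∀ r j q k m → r + (j + q * k) * m ≡ (r + j * m) + q * (k * m)
  regroup = solve-∀

refine : ∀ {m r n} k .{{_ : NonZero k}} → InProgression m r n →
  Σ[ j ∈ Fin k ] InProgression (k * m) (r + toℕ j * m) n
refine {m} {r} {n} k (member t n≡) with t divMod k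
... | result q j t≡ = j , member q (begin
  n                              ≡⟨ n≡ ⟩
  r + t * m                      ≡⟨ cong (λ t → r + t * m) t≡ ⟩
  r + (toℕ j + q * k) * m        ≡⟨ regroup r (toℕ j) q k m ⟩
  (r + toℕ j * m) + q * (k * m)  ∎)
  where open ≡-Reasoning

Exceptional : ℕ → Set
Exceptional n = (n % 168 ≡ 1) ⊎ (n % 168 ≡ 25) ⊎ (n % 168 ≡ 121)

classify1mod24 : ∀ {n} → InProgression 24 1 n → n ∈𝒞 2 ⊎ Exceptional n
classify1mod24 p with refine 7 p
... | 0F , q = inj₂ (inj₁ (residueIn q))
... | 1F , q = inj₂ (inj₂ (inj₁ (residueIn q)))
... | 2F , q = inj₁ (coveredBy fortyNineMod168 q)
... | 3F , q = inj₁ (coveredBy seventyThreeMod168 q)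
... | 4F , q = inj₁ (coveredBy ninetySevenMod168 q)
... | 5F , q = inj₂ (inj₂ (inj₂ (residueIn q)))
... | 6F , q = inj₁ (coveredBy oneFortyFiveMod168 q)

classify1mod8 : ∀ {n} → InProgression 8 1 n → n ∈𝒞 2 ⊎ Exceptional n
classify1mod8 p with refine 3 p
... | 0F , q = classify1mod24 q
... | 1F , q = inj₁ (coveredBy nineMod24 q)
... | 2F , q = inj₁ (coveredBy seventeenMod24 q)

classify1mod4 : ∀ {n} → InProgression 4 1 n → n ∈𝒞 2 ⊎ Exceptional n
classify1mod4 p with refine 2 p
... | 0F , q = classify1mod8 q
... | 1F , q = inj₁ (coveredBy fiveMod8 q)

classify : ∀ n → .{{_ : NonZero n}} → n ∈𝒞 2 ⊎ Exceptional n
classify n with refine 4 (trivialProgression n)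
... | 0F , member zero    n≡0 = ⊥-elim (≢-nonZero⁻¹ n n≡0)
... | 0F , member (suc t) n≡  = inj₁ (coveredBy fourMultiples (member t n≡))
... | 1F , q = classify1mod4 q
... | 2F , q = inj₁ (coveredBy twoMod4 q)
... | 3F , q = inj₁ (coveredBy threeMod4 q)

proposition1p4 : (n : ℕ) → .{{_ : NonZero n}} → ¬ (n ∈𝒞 2) →
    (n % 168 ≡ 1) ⊎ (n % 168 ≡ 25) ⊎ (n % 168 ≡ 121)
proposition1p4 n n∉𝒞₂ with classify n
... | inj₁ n∈𝒞₂      = ⊥-elim (n∉𝒞₂ n∈𝒞₂)
... | inj₂ exception = exception
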